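{- (1) For all integers $k\ge 3$ and $j\ge 1$, $N_{2\times 8}(j,k;j,1,1,1)=2^{(k-3)(j-1)}N_{2\times 8}(1,k;1,1,1,1)$. (2) For all positive integers $r$ and all integers $s\ge 2$, $$N_{2\times 8}(r,s;r,0,1,s-1)=N_{2\times 8}(r,s;r,0,s-1,1)=N_{2\times 8}(r,s;r,s-1,1,0)=N_{2\times 8}(r,s;r,1,s-1,0)=2^s-1.$$ (3) For all positive integers $r,s$ and all integers $0\le k\le s$, $N_{2\times 8}(r,s;r,0,k,s-k)=N_{2\times 8}(r,s;r,s-k,k,0)$ and $N_{2\times 8}(r,s;r,k,0,s-k)=N_{2\times 8}(r,s;r,s-k,0,k)$.
   Context: For non-negative integers $\alpha,\beta,k_0,k_1,k_2,k_3$, $N_{2\times 8}(\alpha,\beta;k_0,k_1,k_2,k_3)=\frac{N_1N_2N_3N_4}{D_1D_2D_3D_4}$ with $N_1=\prod_{i=0}^{k_0-1}((2^{\alpha}-2^{i})2^{\beta})$, $N_2=\prod_{i=0}^{k_1-1}((8^{\beta}-4^{\beta}2^{i})2^{\alpha})$, $N_3=\prod_{i=0}^{k_2-1}((4^{\beta}-2^{\beta+k_1+i})2^{\alpha})$, $N_4=\prod_{i=0}^{k_3-1}(2^{\beta}-2^{k_1+k_2+i})$, $D_1=\prod_{i=0}^{k_0-1}(2^{k_0+k_1+k_2+k_3}-2^{k_1+k_2+k_3+i})$, $D_2=\prod_{i=0}^{k_1-1}((8^{k_1}-4^{k_1}2^{i})2^{k_0+2k_2+k_3})$, $D_3=\prod_{i=0}^{k_2-1}((4^{k_2}-2^{k_2+i})2^{k_0+2k_1+k_3})$,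 $D_4=\prod_{i=0}^{k_3-1}(2^{k_1+k_2+k_3}-2^{k_1+k_2+i})$; empty products equal $1$. -}

module Defs where

open import Data.Nat as ℕ using (ℕ; zero; suc; _+_; _*_; _^_)
open import Data.Integer as ℤ using (ℤ; +_) renaming (_*_ to _*ℤ_; _-_ to _-ℤ_)
open import Data.Rational as ℚ using (ℚ; 0ℚ; ≢-nonZero; _÷_)
open import Data.Rational.Properties using () renaming (_≟_ to _≟ℚ_)
open import Relation.Nullary using (yes; no)

prod : ℕ → (ℕ → ℤ) → ℤ
prod zero    f = + 1
prod (suc k) f = prod k f *ℤ f k

ι : ℕ → ℤ
ι n = + n

-- total division on ℚ (returns 0 when the divisor is 0; all denominators
-- D₁…D₄ are positive, so this case never arises for N2x8)
_÷₀_ : ℚ → ℚ → ℚ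
p ÷₀ q with q ≟ℚ 0ℚ
... | yes _  = 0ℚ
... | no q≢0 = _÷_ p q {{≢-nonZero q≢0}}

module _ (α β k₀ k₁ k₂ k₃ : ℕ) where
  N₁ N₂ N₃ N₄ D₁ D₂ D₃ D₄ : ℤ
  N₁ = prod k₀ (λ i → (ι (2 ^ α) -ℤ ι (2 ^ i)) *ℤ ι (2 ^ β))
  N₂ = prod k₁ (λ i → (ι (8 ^ β) -ℤ ι (4 ^ β * 2 ^ i)) *ℤ ι (2 ^ α))
  N₃ = prod k₂ (λ i → (ι (4 ^ β) -ℤ ι (2 ^ (β + k₁ + i))) *ℤ ι (2 ^ α))
  N₄ = prod k₃ (λ i → ι (2 ^ β) -ℤ ι (2 ^ (k₁ + k₂ + i)))
  D₁ = prod k₀ (λ i → ι (2 ^ (k₀ + k₁ + k₂ + k₃)) -ℤ ι (2 ^ (k₁ + k₂ + k₃ + i)))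
  D₂ = prod k₁ (λ i → (ι (8 ^ k₁) -ℤ ι (4 ^ k₁ * 2 ^ i)) *ℤ ι (2 ^ (k₀ + 2 * k₂ + k₃)))
  D₃ = prod k₂ (λ i → (ι (4 ^ k₂) -ℤ ι (2 ^ (k₂ + i))) *ℤ ι (2 ^ (k₀ + 2 * k₁ + k₃)))
  D₄ = prod k₃ (λ i → ι (2 ^ (k₁ + k₂ + k₃)) -ℤ ι (2 ^ (k₁ + k₂ + i)))

  N2x8 : ℚ
  N2x8 = ℚ._/_ (N₁ *ℤ N₂ *ℤ N₃ *ℤ N₄) 1 ÷₀ ℚ._/_ (D₁ *ℤ D₂ *ℤ D₃ *ℤ D₄) 1

-- Every factor of N₁, …, D₄ is a power of 2 times a factor 2ᵃ − 2ⁱ of ∏_{i<k} (2ᵃ − 2ⁱ), the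
-- number of linearly independent k-tuples in 𝔽₂ᵃ. For α = k₀ and β = k₁ + k₂ + k₃ + m the
-- tuples for k₀ cancel, and N_{2×8} is 2^{m(k₀+2k₁+k₂)+k₁k₃} times the product of Gaussian
-- binomials [β;k₁]₂ [β−k₁;k₂]₂ [β−k₁−k₂;k₃]₂. Part (1) only compares the powers of 2; parts
-- (2) and (3) follow from [n;0]₂ = [n;n]₂ = 1, [n;1]₂ = 2ⁿ − 1 and the symmetry
-- [k+l;k]₂ = [k+l;l]₂, obtained by splitting ∏_{i<k+l} (2^{k+l} − 2ⁱ) after l or after k factors.

module Submission where

open import Defs
open import Data.Nat using (ℕ; _≤_; _∸_; _*_; _^_)
open import Data.Integer using (+_; _-_)
open import Data.Rational using (ℚ; _/_) renaming (_*_ to _*ℚ_)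
open import Data.Product using (_×_)
open import Relation.Binary.PropositionalEquality using (_≡_)

open import Data.Nat using (zero; suc; _+_; _<_; z≤n; s≤s)
import Data.Nat.Properties as ℕP
import Data.Nat.Tactic.RingSolver as ℕ-Solver
open import Data.Nat.Coprimality using (1-coprimeTo) renaming (sym to coprime-sym)
open import Data.Integer using (ℤ; 0ℤ; 1ℤ) renaming (_*_ to _*ℤ_)
import Data.Integer.Properties as ℤP
open import Data.Integer.Tactic.RingSolver using (solve-∀; solve)
open import Data.List using (_∷_; [])
open import Data.Rational using (0ℚ; 1ℚ; mkℚ; ↥_; 1/_; ≢-nonZero)
import Data.Rational.Properties as ℚP
open import Data.Product using (_,_)
open import Data.Sum using ([_,_]′)
open import Relation.Binary.PropositionalEquality
  using (_≢_; refl; sym; trans; cong; cong₂; subst; module ≡-Reasoning)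
open import Relation.Nullary using (yes; no; contradiction)

open ≡-Reasoning

/1-as-mkℚ : ∀ i → i / 1 ≡ mkℚ i 0 (coprime-sym (1-coprimeTo _))
/1-as-mkℚ i = ℚP.↥p/↧p≡p (mkℚ i 0 _)

/1-* : ∀ i j → (i *ℤ j) / 1 ≡ (i / 1) *ℚ (j / 1)
/1-* i j rewrite /1-as-mkℚ i | /1-as-mkℚ j = refl

/1-≢0 : ∀ {i} → i ≢ 0ℤ → i / 1 ≢ 0ℚ
/1-≢0 {i} i≢0 i/1≡0 = i≢0 (trans (cong ↥_ (sym (/1-as-mkℚ i))) (ℚP.p≡0⇒↥p≡0 _ i/1≡0))

÷₀-*-inverse : ∀ p {q} → q ≢ 0ℚ → (p ÷₀ q) *ℚ q ≡ p
÷₀-*-inverse p {q} q≢0 with q ℚP.≟ 0ℚ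
... | yes q≡0 = contradiction q≡0 q≢0
... | no q≢0′ = begin
  p *ℚ 1/ q *ℚ q    ≡⟨ ℚP.*-assoc p _ q ⟩
  p *ℚ (1/ q *ℚ q)  ≡⟨ cong (p *ℚ_) (ℚP.*-inverseˡ q) ⟩
  p *ℚ 1ℚ           ≡⟨ ℚP.*-identityʳ p ⟩
  p                 ∎
  where instance _ = ≢-nonZero q≢0′

*-cancelʳ-≡ : ∀ {p r q} → q ≢ 0ℚ → p *ℚ q ≡ r *ℚ q → p ≡ r
*-cancelʳ-≡ {p} {r} {q} q≢0 pq≡rq = begin
  p                 ≡⟨ undo p ⟨
  p *ℚ q *ℚ 1/ q    ≡⟨ cong (_*ℚ 1/ q) pq≡rq ⟩
  r *ℚ q *ℚ 1/ q    ≡⟨ undo r ⟩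
  r                 ∎
  where
  instance _ = ≢-nonZero q≢0
  undo : ∀ x → x *ℚ q *ℚ 1/ q ≡ x
  undo x = trans (ℚP.*-assoc x q _) (trans (cong (x *ℚ_) (ℚP.*-inverseʳ q)) (ℚP.*-identityʳ x))

÷₀-unique : ∀ {p q x} → q ≢ 0ℚ → x *ℚ q ≡ p → p ÷₀ q ≡ x
÷₀-unique {p} q≢0 xq≡p = *-cancelʳ-≡ q≢0 (trans (÷₀-*-inverse p q≢0) (sym xq≡p))

*-÷₀-assoc : ∀ p q r → p *ℚ (q ÷₀ r) ≡ (p *ℚ q) ÷₀ r
*-÷₀-assoc p q r with r ℚP.≟ 0ℚ
... | yes _ = ℚP.*-zeroʳ p
... | no _  = sym (ℚP.*-assoc p q _)

*-≢0 : ∀ {i j} → i ≢ 0ℤ → j ≢ 0ℤ → i *ℤ j ≢ 0ℤ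
*-≢0 {i} i≢0 j≢0 ij≡0 = [ i≢0 , j≢0 ]′ (ℤP.i*j≡0⇒i≡0∨j≡0 i ij≡0)

/1-÷₀-/1-≡ : ∀ c {i j} → j ≢ 0ℤ → i ≡ c *ℤ j → (i / 1) ÷₀ (j / 1) ≡ c / 1
/1-÷₀-/1-≡ c {i} {j} j≢0 i≡cj = ÷₀-unique (/1-≢0 j≢0) (trans (sym (/1-* c j)) (cong (_/ 1) (sym i≡cj)))

/1-÷₀-/1-cancelʳ : ∀ {i j k} → j ≢ 0ℤ → k ≢ 0ℤ → ((i *ℤ k) / 1) ÷₀ ((j *ℤ k) / 1) ≡ (i / 1) ÷₀ (j / 1)
/1-÷₀-/1-cancelʳ {i} {j} {k} j≢0 k≢0 = ÷₀-unique (/1-≢0 (*-≢0 j≢0 k≢0)) (begin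
  x *ℚ ((j *ℤ k) / 1)         ≡⟨ cong (x *ℚ_) (/1-* j k) ⟩
  x *ℚ ((j / 1) *ℚ (k / 1))   ≡⟨ ℚP.*-assoc x _ _ ⟨
  x *ℚ (j / 1) *ℚ (k / 1)     ≡⟨ cong (_*ℚ (k / 1)) (÷₀-*-inverse (i / 1) (/1-≢0 j≢0)) ⟩
  (i / 1) *ℚ (k / 1)          ≡⟨ /1-* i k ⟨
  (i *ℤ k) / 1                ∎)
  where
  x : ℚ
  x = (i / 1) ÷₀ (j / 1)

/1-÷₀-/1-cross : ∀ i {j} i′ {j′} → j ≢ 0ℤ → j′ ≢ 0ℤ → i *ℤ j′ ≡ i′ *ℤ j →
                 (i / 1) ÷₀ (j / 1) ≡ (i′ / 1) ÷₀ (j′ / 1)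
/1-÷₀-/1-cross i {j} i′ {j′} j≢0 j′≢0 ij′≡i′j = begin
  (i / 1) ÷₀ (j / 1)                      ≡⟨ /1-÷₀-/1-cancelʳ {i} j≢0 j′≢0 ⟨
  ((i *ℤ j′) / 1) ÷₀ ((j *ℤ j′) / 1)      ≡⟨ cong₂ (λ a b → (a / 1) ÷₀ (b / 1)) ij′≡i′j (ℤP.*-comm j j′) ⟩
  ((i′ *ℤ j) / 1) ÷₀ ((j′ *ℤ j) / 1)      ≡⟨ /1-÷₀-/1-cancelʳ {i′} j′≢0 j≢0 ⟩
  (i′ / 1) ÷₀ (j′ / 1)                    ∎

prod-cong : ∀ k {f g : ℕ → ℤ} → (∀ i → f i ≡ g i) → prod k f ≡ prod k g
prod-cong zero    f≗g = refl
prod-cong (suc k) f≗g = cong₂ _*ℤ_ (prod-cong k f≗g) (f≗g k)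

prod-distrib-* : ∀ k (f g : ℕ → ℤ) → prod k (λ i → f i *ℤ g i) ≡ prod k f *ℤ prod k g
prod-distrib-* zero    f g = refl
prod-distrib-* (suc k) f g =
  trans (cong (_*ℤ (f k *ℤ g k)) (prod-distrib-* k f g)) (interchange (prod k f) (prod k g) (f k) (g k))
  where
  interchange : ∀ a b c d → a *ℤ b *ℤ (c *ℤ d) ≡ a *ℤ c *ℤ (b *ℤ d)
  interchange = solve-∀

prod-+ : ∀ m n (f : ℕ → ℤ) → prod (m + n) f ≡ prod m f *ℤ prod n (λ i → f (m + i))
prod-+ m zero    f = trans (cong (λ k → prod k f) (ℕP.+-identityʳ m)) (sym (ℤP.*-identityʳ _))
prod-+ m (suc n) f = begin
  prod (m + suc n) f                                        ≡⟨ cong (λ k → prod k f) (ℕP.+-suc m n) ⟩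
  prod (m + n) f *ℤ f (m + n)                               ≡⟨ cong (_*ℤ f (m + n)) (prod-+ m n f) ⟩
  prod m f *ℤ prod n (λ i → f (m + i)) *ℤ f (m + n)         ≡⟨ ℤP.*-assoc (prod m f) _ _ ⟩
  prod m f *ℤ (prod n (λ i → f (m + i)) *ℤ f (m + n))       ∎

prod-≢0 : ∀ k {f} → (∀ i → i < k → f i ≢ 0ℤ) → prod k f ≢ 0ℤ
prod-≢0 zero    _   = λ ()
prod-≢0 (suc k) f≢0 = *-≢0 (prod-≢0 k (λ i i<k → f≢0 i (ℕP.m<n⇒m<1+n i<k))) (f≢0 k ℕP.≤-refl)

ι-2^-+ : ∀ m n → ι (2 ^ (m + n)) ≡ ι (2 ^ m) *ℤ ι (2 ^ n)
ι-2^-+ m n = trans (cong +_ (ℕP.^-distribˡ-+-* 2 m n)) (ℤP.pos-* (2 ^ m) (2 ^ n))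

ι-2^-≢0 : ∀ e → ι (2 ^ e) ≢ 0ℤ
ι-2^-≢0 e 2^e≡0 = ℕP.<⇒≢ (ℕP.m^n>0 2 e) (sym (ℤP.+-injective 2^e≡0))

prod-ι-2^ : ∀ d k → prod k (λ _ → ι (2 ^ d)) ≡ ι (2 ^ (k * d))
prod-ι-2^ d zero    = refl
prod-ι-2^ d (suc k) =
  trans (cong (_*ℤ ι (2 ^ d)) (prod-ι-2^ d k))
        (trans (ℤP.*-comm (ι (2 ^ (k * d))) (ι (2 ^ d))) (sym (ι-2^-+ d (k * d))))

linIndep : ℕ → ℕ → ℤ
linIndep a k = prod k (λ i → ι (2 ^ a) - ι (2 ^ i))

linIndep-≢0 : ∀ {a k} → k ≤ a → linIndep a k ≢ 0ℤ
linIndep-≢0 {a} {k} k≤a = prod-≢0 k λ i i<k gap≡0 →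
  ℕP.<⇒≢ (ℕP.^-monoʳ-< 2 (s≤s (s≤s z≤n)) (ℕP.<-≤-trans i<k k≤a))
         (sym (ℤP.+-injective (ℤP.i-j≡0⇒i≡j _ _ gap≡0)))

prod-gaps : ∀ k c a d {f : ℕ → ℤ} →
            (∀ i → f i ≡ (ι (2 ^ (c + a)) - ι (2 ^ (c + i))) *ℤ ι (2 ^ d)) →
            prod k f ≡ ι (2 ^ (k * (d + c))) *ℤ linIndep a k
prod-gaps k c a d {f} f≗gap = begin
  prod k f                                                    ≡⟨ prod-cong k (λ i → trans (f≗gap i) (scaled-gap i)) ⟩
  prod k (λ i → ι (2 ^ (d + c)) *ℤ (ι (2 ^ a) - ι (2 ^ i)))   ≡⟨ prod-distrib-* k _ _ ⟩
  prod k (λ _ → ι (2 ^ (d + c))) *ℤ linIndep a k              ≡⟨ cong (_*ℤ linIndep a k) (prod-ι-2^ (d + c) k) ⟩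
  ι (2 ^ (k * (d + c))) *ℤ linIndep a k                       ∎
  where
  factor-out : ∀ x y u v → (x *ℤ u - x *ℤ v) *ℤ y ≡ y *ℤ x *ℤ (u - v)
  factor-out = solve-∀
  scaled-gap : ∀ i → (ι (2 ^ (c + a)) - ι (2 ^ (c + i))) *ℤ ι (2 ^ d) ≡ ι (2 ^ (d + c)) *ℤ (ι (2 ^ a) - ι (2 ^ i))
  scaled-gap i = begin
    (ι (2 ^ (c + a)) - ι (2 ^ (c + i))) *ℤ ι (2 ^ d)
      ≡⟨ cong₂ (λ x y → (x - y) *ℤ ι (2 ^ d)) (ι-2^-+ c a) (ι-2^-+ c i) ⟩
    (ι (2 ^ c) *ℤ ι (2 ^ a) - ι (2 ^ c) *ℤ ι (2 ^ i)) *ℤ ι (2 ^ d)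
      ≡⟨ factor-out (ι (2 ^ c)) (ι (2 ^ d)) (ι (2 ^ a)) (ι (2 ^ i)) ⟩
    ι (2 ^ d) *ℤ ι (2 ^ c) *ℤ (ι (2 ^ a) - ι (2 ^ i))
      ≡⟨ cong (_*ℤ (ι (2 ^ a) - ι (2 ^ i))) (ι-2^-+ d c) ⟨
    ι (2 ^ (d + c)) *ℤ (ι (2 ^ a) - ι (2 ^ i)) ∎

linIndep-+ : ∀ k l → linIndep (k + l) (l + k) ≡ linIndep (k + l) l *ℤ (ι (2 ^ (k * l)) *ℤ linIndep k k)
linIndep-+ k l = trans (prod-+ l k _) (cong (linIndep (k + l) l *ℤ_) (prod-gaps k l k 0 top-gap))
  where
  top-gap : ∀ i → ι (2 ^ (k + l)) - ι (2 ^ (l + i)) ≡ (ι (2 ^ (l + k)) - ι (2 ^ (l + i))) *ℤ 1ℤ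
  top-gap i = trans (cong (λ e → ι (2 ^ e) - ι (2 ^ (l + i))) (ℕP.+-comm k l)) (sym (ℤP.*-identityʳ _))

gaussian-binomial-sym : ∀ k l → linIndep (k + l) k *ℤ linIndep l l ≡ linIndep (k + l) l *ℤ linIndep k k
gaussian-binomial-sym k l = ℤP.*-cancelˡ-≡ (ι (2 ^ (k * l))) _ _ {{ℕP.m^n≢0 2 (k * l)}} (begin
  ι (2 ^ (k * l)) *ℤ (linIndep (k + l) k *ℤ linIndep l l)    ≡⟨ swap (ι (2 ^ (k * l))) (linIndep (k + l) k) _ ⟩
  linIndep (k + l) k *ℤ (ι (2 ^ (k * l)) *ℤ linIndep l l)    ≡⟨ cong (λ e → linIndep (k + l) k *ℤ (ι (2 ^ e) *ℤ linIndep l l)) (ℕP.*-comm k l) ⟩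
  linIndep (k + l) k *ℤ (ι (2 ^ (l * k)) *ℤ linIndep l l)    ≡⟨ cong (λ n → linIndep n k *ℤ (ι (2 ^ (l * k)) *ℤ linIndep l l)) (ℕP.+-comm k l) ⟩
  linIndep (l + k) k *ℤ (ι (2 ^ (l * k)) *ℤ linIndep l l)    ≡⟨ linIndep-+ l k ⟨
  linIndep (l + k) (k + l)                                   ≡⟨ cong₂ linIndep (ℕP.+-comm l k) (ℕP.+-comm k l) ⟩
  linIndep (k + l) (l + k)                                   ≡⟨ linIndep-+ k l ⟩
  linIndep (k + l) l *ℤ (ι (2 ^ (k * l)) *ℤ linIndep k k)    ≡⟨ swap (linIndep (k + l) l) (ι (2 ^ (k * l))) _ ⟩
  ι (2 ^ (k * l)) *ℤ (linIndep (k + l) l *ℤ linIndep k k)    ∎)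
  where
  swap : ∀ x y z → x *ℤ (y *ℤ z) ≡ y *ℤ (x *ℤ z)
  swap = solve-∀

gaussian-binomial-sym-∸ : ∀ {s k} → k ≤ s → linIndep s k *ℤ linIndep (s ∸ k) (s ∸ k) ≡ linIndep s (s ∸ k) *ℤ linIndep k k
gaussian-binomial-sym-∸ {s} {k} k≤s =
  subst (λ n → linIndep n k *ℤ linIndep (s ∸ k) (s ∸ k) ≡ linIndep n (s ∸ k) *ℤ linIndep k k)
        (ℕP.m+[n∸m]≡n k≤s) (gaussian-binomial-sym k (s ∸ k))

linIndep[1+p,p] : ∀ p → linIndep (suc p) p ≡ (ι (2 ^ suc p) - 1ℤ) *ℤ linIndep p p
linIndep[1+p,p] p = subst (λ n → linIndep n p ≡ (ι (2 ^ n) - 1ℤ) *ℤ linIndep p p) (ℕP.+-comm p 1) (begin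
  linIndep (p + 1) p                             ≡⟨ ℤP.*-identityʳ _ ⟨
  linIndep (p + 1) p *ℤ linIndep 1 1             ≡⟨ gaussian-binomial-sym p 1 ⟩
  linIndep (p + 1) 1 *ℤ linIndep p p             ≡⟨ cong (_*ℤ linIndep p p) (ℤP.*-identityˡ (ι (2 ^ (p + 1)) - 1ℤ)) ⟩
  (ι (2 ^ (p + 1)) - 1ℤ) *ℤ linIndep p p         ∎)

4^≡2^[2*] : ∀ b → 4 ^ b ≡ 2 ^ (2 * b)
4^≡2^[2*] = ℕP.^-*-assoc 2 2

8^-gap : ∀ b i → ι (8 ^ b) - ι (4 ^ b * 2 ^ i) ≡ ι (2 ^ (2 * b + b)) - ι (2 ^ (2 * b + i))
8^-gap b i = cong₂ (λ x y → ι x - ι y)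
  (trans (ℕP.^-*-assoc 2 3 b) (cong (2 ^_) (ℕP.+-comm b (2 * b))))
  (trans (cong (_* 2 ^ i) (4^≡2^[2*] b)) (sym (ℕP.^-distribˡ-+-* 2 (2 * b) i)))

four-factors : ∀ {x₁ x₂ x₃ x₄} e₁ e₂ e₃ e₄ l₀ l₁ l₂ l₃ →
  x₁ ≡ ι (2 ^ e₁) *ℤ l₀ → x₂ ≡ ι (2 ^ e₂) *ℤ l₁ → x₃ ≡ ι (2 ^ e₃) *ℤ l₂ → x₄ ≡ ι (2 ^ e₄) *ℤ l₃ →
  x₁ *ℤ x₂ *ℤ x₃ *ℤ x₄ ≡ ι (2 ^ (e₁ + e₂ + e₃ + e₄)) *ℤ (l₀ *ℤ (l₁ *ℤ l₂ *ℤ l₃))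
four-factors e₁ e₂ e₃ e₄ l₀ l₁ l₂ l₃ refl refl refl refl = begin
  p₁ *ℤ l₀ *ℤ (p₂ *ℤ l₁) *ℤ (p₃ *ℤ l₂) *ℤ (p₄ *ℤ l₃)    ≡⟨ regroup p₁ p₂ p₃ p₄ l₀ l₁ l₂ l₃ ⟩
  p₁ *ℤ p₂ *ℤ p₃ *ℤ p₄ *ℤ (l₀ *ℤ (l₁ *ℤ l₂ *ℤ l₃))      ≡⟨ cong (_*ℤ (l₀ *ℤ (l₁ *ℤ l₂ *ℤ l₃))) powers ⟨
  ι (2 ^ (e₁ + e₂ + e₃ + e₄)) *ℤ (l₀ *ℤ (l₁ *ℤ l₂ *ℤ l₃)) ∎
  where
  p₁ p₂ p₃ p₄ : ℤ
  p₁ = ι (2 ^ e₁); p₂ = ι (2 ^ e₂); p₃ = ι (2 ^ e₃); p₄ = ι (2 ^ e₄)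
  regroup : ∀ p₁ p₂ p₃ p₄ l₀ l₁ l₂ l₃ →
    p₁ *ℤ l₀ *ℤ (p₂ *ℤ l₁) *ℤ (p₃ *ℤ l₂) *ℤ (p₄ *ℤ l₃) ≡ p₁ *ℤ p₂ *ℤ p₃ *ℤ p₄ *ℤ (l₀ *ℤ (l₁ *ℤ l₂ *ℤ l₃))
  regroup = solve-∀
  powers : ι (2 ^ (e₁ + e₂ + e₃ + e₄)) ≡ p₁ *ℤ p₂ *ℤ p₃ *ℤ p₄
  powers = trans (ι-2^-+ (e₁ + e₂ + e₃) e₄) (cong (_*ℤ p₄)
           (trans (ι-2^-+ (e₁ + e₂) e₃) (cong (_*ℤ p₃) (ι-2^-+ e₁ e₂))))

Num Den : (α β k₀ k₁ k₂ k₃ : ℕ) → ℤ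
Num α β k₀ k₁ k₂ k₃ = N₁ α β k₀ k₁ k₂ k₃ *ℤ N₂ α β k₀ k₁ k₂ k₃ *ℤ N₃ α β k₀ k₁ k₂ k₃ *ℤ N₄ α β k₀ k₁ k₂ k₃
Den α β k₀ k₁ k₂ k₃ = D₁ α β k₀ k₁ k₂ k₃ *ℤ D₂ α β k₀ k₁ k₂ k₃ *ℤ D₃ α β k₀ k₁ k₂ k₃ *ℤ D₄ α β k₀ k₁ k₂ k₃

Num-exponent : (α β k₀ k₁ k₂ k₃ : ℕ) → ℕ
Num-exponent α β k₀ k₁ k₂ k₃ = k₀ * (β + 0) + k₁ * (α + 2 * β) + k₂ * (α + (β + k₁)) + k₃ * (k₁ + k₂)

Den-exponent : (k₀ k₁ k₂ k₃ : ℕ) → ℕ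
Den-exponent k₀ k₁ k₂ k₃ =
  k₀ * (k₁ + k₂ + k₃) + k₁ * (k₀ + 2 * k₂ + k₃ + 2 * k₁) + k₂ * (k₀ + 2 * k₁ + k₃ + k₂) + k₃ * (k₁ + k₂)

Num-factorisation : ∀ {β a₃ a₄} α k₀ k₁ k₂ k₃ → β ≡ k₁ + a₃ → a₃ ≡ k₂ + a₄ →
  Num α β k₀ k₁ k₂ k₃ ≡ ι (2 ^ Num-exponent α β k₀ k₁ k₂ k₃)
    *ℤ (linIndep α k₀ *ℤ (linIndep β k₁ *ℤ linIndep a₃ k₂ *ℤ linIndep a₄ k₃))
Num-factorisation {β} {a₃} {a₄} α k₀ k₁ k₂ k₃ β≡k₁+a₃ a₃≡k₂+a₄ =
  four-factors (k₀ * (β + 0)) (k₁ * (α + 2 * β)) (k₂ * (α + (β + k₁))) (k₃ * (k₁ + k₂))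
               (linIndep α k₀) (linIndep β k₁) (linIndep a₃ k₂) (linIndep a₄ k₃)
  (prod-gaps k₀ 0 α β λ _ → refl)
  (prod-gaps k₁ (2 * β) β α λ i → cong (_*ℤ ι (2 ^ α)) (8^-gap β i))
  (prod-gaps k₂ (β + k₁) a₃ α λ i → cong (λ n → (ι n - ι (2 ^ (β + k₁ + i))) *ℤ ι (2 ^ α)) 4^β≡2^[β+k₁+a₃])
  (prod-gaps k₃ (k₁ + k₂) a₄ 0 λ i → trans (cong (λ n → ι (2 ^ n) - ι (2 ^ (k₁ + k₂ + i))) β≡k₁+k₂+a₄)
                                           (sym (ℤP.*-identityʳ (ι (2 ^ (k₁ + k₂ + a₄)) - ι (2 ^ (k₁ + k₂ + i))))))
  where
  4^β≡2^[β+k₁+a₃] : 4 ^ β ≡ 2 ^ (β + k₁ + a₃)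
  4^β≡2^[β+k₁+a₃] = trans (4^≡2^[2*] β) (cong (2 ^_)
    (trans (cong (λ n → β + n) (trans (ℕP.+-identityʳ β) β≡k₁+a₃)) (sym (ℕP.+-assoc β k₁ a₃))))
  β≡k₁+k₂+a₄ : β ≡ k₁ + k₂ + a₄
  β≡k₁+k₂+a₄ = trans β≡k₁+a₃ (trans (cong (λ n → k₁ + n) a₃≡k₂+a₄) (sym (ℕP.+-assoc k₁ k₂ a₄)))

GL-orders : ℕ → ℕ → ℕ → ℤ
GL-orders k₁ k₂ k₃ = linIndep k₁ k₁ *ℤ linIndep k₂ k₂ *ℤ linIndep k₃ k₃

GL-orders-≢0 : ∀ k₁ k₂ k₃ → GL-orders k₁ k₂ k₃ ≢ 0ℤ
GL-orders-≢0 k₁ k₂ k₃ =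
  *-≢0 (*-≢0 (linIndep-≢0 {k₁} ℕP.≤-refl) (linIndep-≢0 {k₂} ℕP.≤-refl)) (linIndep-≢0 {k₃} ℕP.≤-refl)

Den-factorisation : ∀ α β k₀ k₁ k₂ k₃ →
  Den α β k₀ k₁ k₂ k₃ ≡ ι (2 ^ Den-exponent k₀ k₁ k₂ k₃) *ℤ (linIndep k₀ k₀ *ℤ GL-orders k₁ k₂ k₃)
Den-factorisation α β k₀ k₁ k₂ k₃ =
  four-factors (k₀ * (k₁ + k₂ + k₃)) (k₁ * (k₀ + 2 * k₂ + k₃ + 2 * k₁)) (k₂ * (k₀ + 2 * k₁ + k₃ + k₂)) (k₃ * (k₁ + k₂))
               (linIndep k₀ k₀) (linIndep k₁ k₁) (linIndep k₂ k₂) (linIndep k₃ k₃)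
  (prod-gaps k₀ (k₁ + k₂ + k₃) k₀ 0 λ i → trans
    (cong (λ n → ι (2 ^ n) - ι (2 ^ (k₁ + k₂ + k₃ + i))) (rotate k₀ k₁ k₂ k₃))
    (sym (ℤP.*-identityʳ (ι (2 ^ (k₁ + k₂ + k₃ + k₀)) - ι (2 ^ (k₁ + k₂ + k₃ + i))))))
  (prod-gaps k₁ (2 * k₁) k₁ (k₀ + 2 * k₂ + k₃) λ i → cong (_*ℤ ι (2 ^ (k₀ + 2 * k₂ + k₃))) (8^-gap k₁ i))
  (prod-gaps k₂ k₂ k₂ (k₀ + 2 * k₁ + k₃) λ i →
    cong (λ n → (ι n - ι (2 ^ (k₂ + i))) *ℤ ι (2 ^ (k₀ + 2 * k₁ + k₃)))
         (trans (4^≡2^[2*] k₂) (cong (λ n → 2 ^ (k₂ + n)) (ℕP.+-identityʳ k₂))))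
  (prod-gaps k₃ (k₁ + k₂) k₃ 0 λ i → sym (ℤP.*-identityʳ (ι (2 ^ (k₁ + k₂ + k₃)) - ι (2 ^ (k₁ + k₂ + i)))))
  where
  rotate : ∀ a b c d → a + b + c + d ≡ b + c + d + a
  rotate = ℕ-Solver.solve-∀

Den-≢0 : ∀ α β k₀ k₁ k₂ k₃ → Den α β k₀ k₁ k₂ k₃ ≢ 0ℤ
Den-≢0 α β k₀ k₁ k₂ k₃ Den≡0 =
  *-≢0 (ι-2^-≢0 (Den-exponent k₀ k₁ k₂ k₃)) (*-≢0 (linIndep-≢0 {k₀} ℕP.≤-refl) (GL-orders-≢0 k₁ k₂ k₃))
       (trans (sym (Den-factorisation α β k₀ k₁ k₂ k₃)) Den≡0)

Num-exponent≡excess+Den-exponent : ∀ k₀ k₁ k₂ k₃ m →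
  k₀ * (k₁ + (k₂ + (k₃ + m)) + 0) + k₁ * (k₀ + 2 * (k₁ + (k₂ + (k₃ + m))))
    + k₂ * (k₀ + (k₁ + (k₂ + (k₃ + m)) + k₁)) + k₃ * (k₁ + k₂)
  ≡ m * (k₀ + 2 * k₁ + k₂) + k₁ * k₃
    + (k₀ * (k₁ + k₂ + k₃) + k₁ * (k₀ + 2 * k₂ + k₃ + 2 * k₁) + k₂ * (k₀ + 2 * k₁ + k₃ + k₂) + k₃ * (k₁ + k₂))
Num-exponent≡excess+Den-exponent = ℕ-Solver.solve-∀

N2x8-closed-form : ∀ {β a₃ a₄ e} k₀ k₁ k₂ k₃ m →
  β ≡ k₁ + a₃ → a₃ ≡ k₂ + a₄ → a₄ ≡ k₃ + m → e ≡ m * (k₀ + 2 * k₁ + k₂) + k₁ * k₃ →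
  N2x8 k₀ β k₀ k₁ k₂ k₃ ≡
    ((ι (2 ^ e) *ℤ (linIndep β k₁ *ℤ linIndep a₃ k₂ *ℤ linIndep a₄ k₃)) / 1) ÷₀ (GL-orders k₁ k₂ k₃ / 1)
N2x8-closed-form {β} {a₃} {a₄} {e} k₀ k₁ k₂ k₃ m β≡k₁+a₃ a₃≡k₂+a₄ a₄≡k₃+m e≡ =
  /1-÷₀-/1-cross (Num k₀ β k₀ k₁ k₂ k₃) (ι (2 ^ e) *ℤ C) (Den-≢0 k₀ β k₀ k₁ k₂ k₃) (GL-orders-≢0 k₁ k₂ k₃) (begin
    Num k₀ β k₀ k₁ k₂ k₃ *ℤ G                      ≡⟨ cong (_*ℤ G) (Num-factorisation k₀ k₀ k₁ k₂ k₃ β≡k₁+a₃ a₃≡k₂+a₄) ⟩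
    ι (2 ^ Num-exponent k₀ β k₀ k₁ k₂ k₃) *ℤ (L₀ *ℤ C) *ℤ G
                                                   ≡⟨ cong (λ n → ι (2 ^ n) *ℤ (L₀ *ℤ C) *ℤ G) exponents ⟩
    ι (2 ^ (e + d)) *ℤ (L₀ *ℤ C) *ℤ G              ≡⟨ cong (λ x → x *ℤ (L₀ *ℤ C) *ℤ G) (ι-2^-+ e d) ⟩
    ι (2 ^ e) *ℤ ι (2 ^ d) *ℤ (L₀ *ℤ C) *ℤ G       ≡⟨ regroup (ι (2 ^ e)) (ι (2 ^ d)) L₀ C G ⟩
    ι (2 ^ e) *ℤ C *ℤ (ι (2 ^ d) *ℤ (L₀ *ℤ G))     ≡⟨ cong (ι (2 ^ e) *ℤ C *ℤ_) (Den-factorisation k₀ β k₀ k₁ k₂ k₃) ⟨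
    ι (2 ^ e) *ℤ C *ℤ Den k₀ β k₀ k₁ k₂ k₃         ∎)
  where
  L₀ C G : ℤ
  L₀ = linIndep k₀ k₀
  C = linIndep β k₁ *ℤ linIndep a₃ k₂ *ℤ linIndep a₄ k₃
  G = GL-orders k₁ k₂ k₃
  d : ℕ
  d = Den-exponent k₀ k₁ k₂ k₃
  regroup : ∀ p q l c g → p *ℤ q *ℤ (l *ℤ c) *ℤ g ≡ p *ℤ c *ℤ (q *ℤ (l *ℤ g))
  regroup = solve-∀
  exponents : Num-exponent k₀ β k₀ k₁ k₂ k₃ ≡ e + d
  exponents = begin
    Num-exponent k₀ β k₀ k₁ k₂ k₃
      ≡⟨ cong (λ b → Num-exponent k₀ b k₀ k₁ k₂ k₃)
              (trans β≡k₁+a₃ (cong (λ a → k₁ + a) (trans a₃≡k₂+a₄ (cong (λ a → k₂ + a) a₄≡k₃+m)))) ⟩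
    Num-exponent k₀ (k₁ + (k₂ + (k₃ + m))) k₀ k₁ k₂ k₃
      ≡⟨ Num-exponent≡excess+Den-exponent k₀ k₁ k₂ k₃ m ⟩
    m * (k₀ + 2 * k₁ + k₂) + k₁ * k₃ + d   ≡⟨ cong (_+ d) e≡ ⟨
    e + d                                  ∎

N2x8[0,k,s∸k]≡N2x8[s∸k,k,0] : ∀ r s k → k ≤ s → N2x8 r s r 0 k (s ∸ k) ≡ N2x8 r s r (s ∸ k) k 0
N2x8[0,k,s∸k]≡N2x8[s∸k,k,0] r s k k≤s = begin
  N2x8 r s r 0 k l
    ≡⟨ N2x8-closed-form r 0 k l 0 refl (sym (ℕP.m+[n∸m]≡n k≤s)) (sym (ℕP.+-identityʳ l)) refl ⟩
  ((1ℤ *ℤ (1ℤ *ℤ A *ℤ L)) / 1) ÷₀ (GL-orders 0 k l / 1)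
    ≡⟨ /1-÷₀-/1-cross (1ℤ *ℤ (1ℤ *ℤ A *ℤ L)) (1ℤ *ℤ (B *ℤ K *ℤ 1ℤ))
                      (GL-orders-≢0 0 k l) (GL-orders-≢0 l k 0) (cross A B K L (gaussian-binomial-sym-∸ k≤s)) ⟩
  ((1ℤ *ℤ (B *ℤ K *ℤ 1ℤ)) / 1) ÷₀ (GL-orders l k 0 / 1)
    ≡⟨ N2x8-closed-form r l k 0 0 (sym (ℕP.m∸n+n≡m k≤s)) (sym (ℕP.+-identityʳ k)) refl (sym (ℕP.*-zeroʳ l)) ⟨
  N2x8 r s r l k 0 ∎
  where
  l : ℕ
  l = s ∸ k
  A B K L : ℤ
  A = linIndep s k
  B = linIndep s l
  K = linIndep k k
  L = linIndep l l
  cross : ∀ A B K L → A *ℤ L ≡ B *ℤ K →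
          1ℤ *ℤ (1ℤ *ℤ A *ℤ L) *ℤ (L *ℤ K *ℤ 1ℤ) ≡ 1ℤ *ℤ (B *ℤ K *ℤ 1ℤ) *ℤ (1ℤ *ℤ K *ℤ L)
  cross A B K L AL≡BK = begin
    1ℤ *ℤ (1ℤ *ℤ A *ℤ L) *ℤ (L *ℤ K *ℤ 1ℤ)  ≡⟨ solve (A ∷ K ∷ L ∷ []) ⟩
    A *ℤ L *ℤ (K *ℤ L)                      ≡⟨ cong (_*ℤ (K *ℤ L)) AL≡BK ⟩
    B *ℤ K *ℤ (K *ℤ L)                      ≡⟨ solve (B ∷ K ∷ L ∷ []) ⟩
    1ℤ *ℤ (B *ℤ K *ℤ 1ℤ) *ℤ (1ℤ *ℤ K *ℤ L)  ∎

N2x8[k,0,s∸k]≡N2x8[s∸k,0,k] : ∀ r s k → k ≤ s → N2x8 r s r k 0 (s ∸ k) ≡ N2x8 r s r (s ∸ k) 0 k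
N2x8[k,0,s∸k]≡N2x8[s∸k,0,k] r s k k≤s = begin
  N2x8 r s r k 0 l
    ≡⟨ N2x8-closed-form r k 0 l 0 (sym (ℕP.m+[n∸m]≡n k≤s)) refl (sym (ℕP.+-identityʳ l)) refl ⟩
  ((P *ℤ (A *ℤ 1ℤ *ℤ L)) / 1) ÷₀ (GL-orders k 0 l / 1)
    ≡⟨ /1-÷₀-/1-cross (P *ℤ (A *ℤ 1ℤ *ℤ L)) (P *ℤ (B *ℤ 1ℤ *ℤ K))
                      (GL-orders-≢0 k 0 l) (GL-orders-≢0 l 0 k) (cross P A B K L (gaussian-binomial-sym-∸ k≤s)) ⟩
  ((P *ℤ (B *ℤ 1ℤ *ℤ K)) / 1) ÷₀ (GL-orders l 0 k / 1)
    ≡⟨ N2x8-closed-form r l 0 k 0 (sym (ℕP.m∸n+n≡m k≤s)) refl (sym (ℕP.+-identityʳ k)) (ℕP.*-comm k l) ⟨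
  N2x8 r s r l 0 k ∎
  where
  l : ℕ
  l = s ∸ k
  P A B K L : ℤ
  P = ι (2 ^ (k * l))
  A = linIndep s k
  B = linIndep s l
  K = linIndep k k
  L = linIndep l l
  cross : ∀ P A B K L → A *ℤ L ≡ B *ℤ K →
          P *ℤ (A *ℤ 1ℤ *ℤ L) *ℤ (L *ℤ 1ℤ *ℤ K) ≡ P *ℤ (B *ℤ 1ℤ *ℤ K) *ℤ (K *ℤ 1ℤ *ℤ L)
  cross P A B K L AL≡BK = begin
    P *ℤ (A *ℤ 1ℤ *ℤ L) *ℤ (L *ℤ 1ℤ *ℤ K)  ≡⟨ solve (P ∷ A ∷ K ∷ L ∷ []) ⟩
    A *ℤ L *ℤ (P *ℤ K *ℤ L)                ≡⟨ cong (_*ℤ (P *ℤ K *ℤ L)) AL≡BK ⟩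
    B *ℤ K *ℤ (P *ℤ K *ℤ L)                ≡⟨ solve (P ∷ B ∷ K ∷ L ∷ []) ⟩
    P *ℤ (B *ℤ 1ℤ *ℤ K) *ℤ (K *ℤ 1ℤ *ℤ L)  ∎

N2x8[0,1,p]≡2^[1+p]-1 : ∀ r p → N2x8 r (suc p) r 0 1 p ≡ (ι (2 ^ suc p) - 1ℤ) / 1
N2x8[0,1,p]≡2^[1+p]-1 r p = begin
  N2x8 r (suc p) r 0 1 p
    ≡⟨ N2x8-closed-form r 0 1 p 0 refl refl (sym (ℕP.+-identityʳ p)) refl ⟩
  ((1ℤ *ℤ (1ℤ *ℤ (1ℤ *ℤ M) *ℤ P)) / 1) ÷₀ (GL-orders 0 1 p / 1)
    ≡⟨ /1-÷₀-/1-≡ M (GL-orders-≢0 0 1 p) (rearrange M (linIndep p p)) ⟩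
  M / 1 ∎
  where
  M P : ℤ
  M = ι (2 ^ suc p) - 1ℤ
  P = linIndep p p
  rearrange : ∀ M P → 1ℤ *ℤ (1ℤ *ℤ (1ℤ *ℤ M) *ℤ P) ≡ M *ℤ (1ℤ *ℤ 1ℤ *ℤ P)
  rearrange = solve-∀

N2x8[0,p,1]≡2^[1+p]-1 : ∀ r p → N2x8 r (suc p) r 0 p 1 ≡ (ι (2 ^ suc p) - 1ℤ) / 1
N2x8[0,p,1]≡2^[1+p]-1 r p = begin
  N2x8 r (suc p) r 0 p 1
    ≡⟨ N2x8-closed-form r 0 p 1 0 refl (ℕP.+-comm 1 p) refl refl ⟩
  ((1ℤ *ℤ (1ℤ *ℤ X *ℤ 1ℤ)) / 1) ÷₀ (GL-orders 0 p 1 / 1)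
    ≡⟨ /1-÷₀-/1-≡ M (GL-orders-≢0 0 p 1) (rearrange M P X (linIndep[1+p,p] p)) ⟩
  M / 1 ∎
  where
  M P X : ℤ
  M = ι (2 ^ suc p) - 1ℤ
  P = linIndep p p
  X = linIndep (suc p) p
  rearrange : ∀ M P X → X ≡ M *ℤ P → 1ℤ *ℤ (1ℤ *ℤ X *ℤ 1ℤ) ≡ M *ℤ (1ℤ *ℤ P *ℤ 1ℤ)
  rearrange M P X X≡MP = begin
    1ℤ *ℤ (1ℤ *ℤ X *ℤ 1ℤ)   ≡⟨ solve (X ∷ []) ⟩
    X                       ≡⟨ X≡MP ⟩
    M *ℤ P                  ≡⟨ solve (M ∷ P ∷ []) ⟩
    M *ℤ (1ℤ *ℤ P *ℤ 1ℤ)    ∎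

N2x8[p,1,0]≡2^[1+p]-1 : ∀ r p → N2x8 r (suc p) r p 1 0 ≡ (ι (2 ^ suc p) - 1ℤ) / 1
N2x8[p,1,0]≡2^[1+p]-1 r p = begin
  N2x8 r (suc p) r p 1 0
    ≡⟨ N2x8-closed-form r p 1 0 0 (ℕP.+-comm 1 p) refl refl (sym (ℕP.*-zeroʳ p)) ⟩
  ((1ℤ *ℤ (X *ℤ 1ℤ *ℤ 1ℤ)) / 1) ÷₀ (GL-orders p 1 0 / 1)
    ≡⟨ /1-÷₀-/1-≡ M (GL-orders-≢0 p 1 0) (rearrange M P X (linIndep[1+p,p] p)) ⟩
  M / 1 ∎
  where
  M P X : ℤ
  M = ι (2 ^ suc p) - 1ℤ
  P = linIndep p p
  X = linIndep (suc p) p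
  rearrange : ∀ M P X → X ≡ M *ℤ P → 1ℤ *ℤ (X *ℤ 1ℤ *ℤ 1ℤ) ≡ M *ℤ (P *ℤ 1ℤ *ℤ 1ℤ)
  rearrange M P X X≡MP = begin
    1ℤ *ℤ (X *ℤ 1ℤ *ℤ 1ℤ)   ≡⟨ solve (X ∷ []) ⟩
    X                       ≡⟨ X≡MP ⟩
    M *ℤ P                  ≡⟨ solve (M ∷ P ∷ []) ⟩
    M *ℤ (P *ℤ 1ℤ *ℤ 1ℤ)    ∎

N2x8[1,p,0]≡2^[1+p]-1 : ∀ r p → N2x8 r (suc p) r 1 p 0 ≡ (ι (2 ^ suc p) - 1ℤ) / 1
N2x8[1,p,0]≡2^[1+p]-1 r p = begin
  N2x8 r (suc p) r 1 p 0
    ≡⟨ N2x8-closed-form r 1 p 0 0 refl (sym (ℕP.+-identityʳ p)) refl refl ⟩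
  ((1ℤ *ℤ (1ℤ *ℤ M *ℤ P *ℤ 1ℤ)) / 1) ÷₀ (GL-orders 1 p 0 / 1)
    ≡⟨ /1-÷₀-/1-≡ M (GL-orders-≢0 1 p 0) (rearrange M (linIndep p p)) ⟩
  M / 1 ∎
  where
  M P : ℤ
  M = ι (2 ^ suc p) - 1ℤ
  P = linIndep p p
  rearrange : ∀ M P → 1ℤ *ℤ (1ℤ *ℤ M *ℤ P *ℤ 1ℤ) ≡ M *ℤ (1ℤ *ℤ P *ℤ 1ℤ)
  rearrange = solve-∀

N2x8[j,1,1,1] : ∀ n m → N2x8 (suc n) (3 + m) (suc n) 1 1 1 ≡ (ι (2 ^ (m * n)) / 1) *ℚ N2x8 1 (3 + m) 1 1 1 1
N2x8[j,1,1,1] n m = begin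
  N2x8 (suc n) (3 + m) (suc n) 1 1 1
    ≡⟨ N2x8-closed-form (suc n) 1 1 1 m refl refl refl (exponent-split m n) ⟩
  ((ι (2 ^ (m * n + e)) *ℤ C) / 1) ÷₀ (G / 1)
    ≡⟨ cong (λ x → ((x *ℤ C) / 1) ÷₀ (G / 1)) (ι-2^-+ (m * n) e) ⟩
  ((c *ℤ ι (2 ^ e) *ℤ C) / 1) ÷₀ (G / 1)
    ≡⟨ cong (λ x → (x / 1) ÷₀ (G / 1)) (ℤP.*-assoc c (ι (2 ^ e)) C) ⟩
  ((c *ℤ (ι (2 ^ e) *ℤ C)) / 1) ÷₀ (G / 1)
    ≡⟨ cong (_÷₀ (G / 1)) (/1-* c (ι (2 ^ e) *ℤ C)) ⟩
  ((c / 1) *ℚ ((ι (2 ^ e) *ℤ C) / 1)) ÷₀ (G / 1)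
    ≡⟨ *-÷₀-assoc (c / 1) ((ι (2 ^ e) *ℤ C) / 1) (G / 1) ⟨
  (c / 1) *ℚ (((ι (2 ^ e) *ℤ C) / 1) ÷₀ (G / 1))
    ≡⟨ cong ((c / 1) *ℚ_) (N2x8-closed-form 1 1 1 1 m refl refl refl refl) ⟨
  (c / 1) *ℚ N2x8 1 (3 + m) 1 1 1 1 ∎
  where
  c C G : ℤ
  c = ι (2 ^ (m * n))
  e : ℕ
  e = m * (1 + 2 * 1 + 1) + 1 * 1
  C = linIndep (3 + m) 1 *ℤ linIndep (2 + m) 1 *ℤ linIndep (1 + m) 1
  G = GL-orders 1 1 1
  exponent-split : ∀ m n → m * n + (m * (1 + 2 * 1 + 1) + 1 * 1) ≡ m * (suc n + 2 * 1 + 1) + 1 * 1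
  exponent-split = ℕ-Solver.solve-∀

lemma5 :
    (∀ (k j : ℕ) → 3 ≤ k → 1 ≤ j →
      N2x8 j k j 1 1 1 ≡ ((+ (2 ^ ((k ∸ 3) * (j ∸ 1)))) / 1) *ℚ N2x8 1 k 1 1 1 1)
    × (∀ (r s : ℕ) → 1 ≤ r → 2 ≤ s →
      (N2x8 r s r 0 1 (s ∸ 1) ≡ ((+ (2 ^ s) - + 1) / 1))
      × (N2x8 r s r 0 (s ∸ 1) 1 ≡ ((+ (2 ^ s) - + 1) / 1))
      × (N2x8 r s r (s ∸ 1) 1 0 ≡ ((+ (2 ^ s) - + 1) / 1))
      × (N2x8 r s r 1 (s ∸ 1) 0 ≡ ((+ (2 ^ s) - + 1) / 1)))
    × (∀ (r s k : ℕ) → 1 ≤ r → 1 ≤ s → k ≤ s →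
      (N2x8 r s r 0 k (s ∸ k) ≡ N2x8 r s r (s ∸ k) k 0)
      × (N2x8 r s r k 0 (s ∸ k) ≡ N2x8 r s r (s ∸ k) 0 k))
lemma5 =
    (λ { (suc (suc (suc m))) (suc n) _ _ → N2x8[j,1,1,1] n m
       ; (suc (suc (suc _))) zero _ ()
       ; (suc (suc zero)) _ (s≤s (s≤s ())) _
       ; (suc zero) _ (s≤s ()) _
       ; zero _ () _ })
  , (λ { r (suc p) _ _ → N2x8[0,1,p]≡2^[1+p]-1 r p , N2x8[0,p,1]≡2^[1+p]-1 r p
                       , N2x8[p,1,0]≡2^[1+p]-1 r p , N2x8[1,p,0]≡2^[1+p]-1 r p
       ; r zero _ () })
  , λ r s k _ _ k≤s → N2x8[0,k,s∸k]≡N2x8[s∸k,k,0] r s k k≤s , N2x8[k,0,s∸k]≡N2x8[s∸k,0,k] r s k k≤s
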